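{- Let $(E_i,\delta_{i,j})_{i\le j\in\mathbb{N}}$ be a direct system of sets with every $E_i$ countable, $u_i:\mathbb{N}\to E_i$ surjections, and $D_i\subset E_i\times E_i$ subsets satisfying $D_{i+1}\supseteq \Delta_{i,i+1}(D_i)\cup\{(x,\delta_{c_\gamma(i),i+1}(u_{c_\gamma(i)}(r_\gamma(i)))): x\in E_{i+1}\}$ for all $i$, where $\Delta_{i,j}=\delta_{i,j}\times\delta_{i,j}$. Let $\varphi_i:D_i\to E_i$ be maps with $\delta_{i,j}\circ\varphi_i=\varphi_j\circ\Delta_{i,j}$ on $D_i$ for all $i\le j$. Then there is a map $\varphi:\varinjlim E_i\times\varinjlim E_i\to\varinjlim E_i$ such that $\varphi\circ(\delta_i\times\delta_i)=\delta_i\circ\varphi_i$ on $D_i$ for all $i\in\mathbb{N}$.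
   Context: A direct system indexed by $\mathbb{N}$: sets $E_i$ with maps $\delta_{i,j}:E_i\to E_j$ ($i\le j$), $\delta_{i,i}=\mathrm{id}$, $\delta_{j,k}\circ\delta_{i,j}=\delta_{i,k}$; $\varinjlim E_i$ is $\bigsqcup E_i$ modulo $x_i\sim y_j$ iff $\delta_{i,k}(x_i)=\delta_{j,k}(y_j)$ for some $k$, with canonical maps $\delta_i:E_i\to\varinjlim E_i$. $\gamma(i,j)=\tfrac12(i+j)(i+j+1)+i$ is the Cantor pairing bijection $\mathbb{N}^2\to\mathbb{N}$ and $\gamma^{ -1}(n)=(c_\gamma(n),r_\gamma(n))$, with $c_\gamma(n)\le n$. -}

module Defs where

open import Data.Nat using (ℕ; zero; suc; _+_; _*_; _≤_; _/_)
open import Data.Product using (Σ; ∃; _×_; _,_; proj₁; proj₂)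
open import Relation.Binary.PropositionalEquality using (_≡_)

γ : ℕ → ℕ → ℕ
γ i j = ((i + j) * suc (i + j)) / 2 + i

-- Its inverse γ⁻¹ : ℕ → ℕ × ℕ, computed by walking the diagonals:
-- the successor of (i, suc j) is (suc i, j), the successor of (i, 0) is (0, suc i).
γ⁻¹ : ℕ → ℕ × ℕ
γ⁻¹ zero = 0 , 0
γ⁻¹ (suc n) with γ⁻¹ n
... | i , zero  = 0 , suc i
... | i , suc j = suc i , j

cγ : ℕ → ℕ
cγ n = proj₁ (γ⁻¹ n)

rγ : ℕ → ℕ
rγ n = proj₂ (γ⁻¹ n)

record DirectSystem : Set₁ where
  field
    E    : ℕ → Set
    δ    : (i j : ℕ) → i ≤ j → E i → E j
    δ-id : ∀ i (p : i ≤ i) (x : E i) → δ i i p x ≡ x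
    δ-∘  : ∀ i j k (p : i ≤ j) (q : j ≤ k) (r : i ≤ k) (x : E i) →
           δ j k q (δ i j p x) ≡ δ i k r x

  -- The direct limit, as the disjoint union ⨆ E_i ...
  Lim : Set
  Lim = Σ ℕ E

  -- ... modulo x_i ∼ y_j iff δ_{i,k} x_i = δ_{j,k} y_j for some k.
  _∼_ : Lim → Lim → Set
  (i , x) ∼ (j , y) = ∃ λ k → Σ (i ≤ k) λ p → Σ (j ≤ k) λ q → δ i k p x ≡ δ j k q y

  ι : (i : ℕ) → E i → Lim
  ι i x = i , x

module Submission where

-- Write (i , x) for an element of the disjoint union ⨆ E_i and ∼ for the
-- direct-limit relation.  Three facts combine:
--  * ∼ is an equivalence relation, and (j , δ_{i,j} x) ∼ (i , x)  (module DirectLimit);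
--  * the domains D_i are stable under the transition maps, and the φ_i are coherent
--    across stages: whenever (x , y) ∈ D_k, (x' , y') ∈ D_k', x ∼ x' and y ∼ y', we get
--    φ_k(x , y) ∼ φ_k'(x' , y')  (module CompatibleMaps, lemma φ-agree);
--  * every pair (x , y) eventually lies in some D_l: the pair (i ⊔ j , n), where
--    u_{i⊔j}(n) represents y, is γ⁻¹(m) for some m (the Cantor enumeration is onto), and
--    the second hypothesis on D_{m+1} puts the images of x and y in D_{m+1}
--    (module Enumerated, lemma reach).
-- Φ(x , y) is then φ_l at such a stage l; φ-agree shows simultaneously that Φ respects ∼
-- and that Φ extends each φ_i.

open import Defs
open import Data.Nat using (ℕ; zero; suc; _+_; _⊔_; _≤_; z≤n; s≤s; _≤′_; ≤′-refl; ≤′-step)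
open import Data.Nat.Properties
  using (≤-refl; ≤-trans; ≤⇒≤′; ≤′⇒≤; m≤n⇒m≤1+n; m≤m⊔n; m≤n⊔m; +-suc; +-identityʳ; suc-injective)
open import Data.Product using (Σ; ∃; _×_; _,_; proj₁; proj₂)
open import Relation.Binary.PropositionalEquality
  using (_≡_; refl; sym; trans; cong; subst; subst₂; module ≡-Reasoning)

γ⁻¹-next-diagonal : ∀ m {b} → γ⁻¹ m ≡ (b , 0) → γ⁻¹ (suc m) ≡ (0 , suc b)
γ⁻¹-next-diagonal m eq rewrite eq = refl

γ⁻¹-along-diagonal : ∀ m {a b} → γ⁻¹ m ≡ (a , suc b) → γ⁻¹ (suc m) ≡ (suc a , b)
γ⁻¹-along-diagonal m eq rewrite eq = refl

γ⁻¹-onto-diagonal : ∀ d a b → a + b ≡ d → ∃ λ m → γ⁻¹ m ≡ (a , b)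
γ⁻¹-onto-diagonal zero    zero zero    refl = 0 , refl
γ⁻¹-onto-diagonal zero    zero (suc b) ()
γ⁻¹-onto-diagonal (suc d) zero zero    ()
γ⁻¹-onto-diagonal (suc d) zero (suc b) e
  with m , eq ← γ⁻¹-onto-diagonal d b 0 (trans (+-identityʳ b) (suc-injective e))
  = suc m , γ⁻¹-next-diagonal m eq
γ⁻¹-onto-diagonal d (suc a) b e
  with m , eq ← γ⁻¹-onto-diagonal d a (suc b) (trans (+-suc a b) e)
  = suc m , γ⁻¹-along-diagonal m eq

γ⁻¹-onto : ∀ a b → ∃ λ m → γ⁻¹ m ≡ (a , b)
γ⁻¹-onto a b = γ⁻¹-onto-diagonal (a + b) a b refl

-- c_γ(n) ≤ n, so δ_{c_γ(n), n+1} makes sense.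
cγ-≤ : ∀ n → cγ n ≤ n
cγ-≤ zero = z≤n
cγ-≤ (suc n) with γ⁻¹ n | cγ-≤ n
... | i , zero  | _   = z≤n
... | i , suc j | c≤n = s≤s c≤n

module DirectLimit (S : DirectSystem) where
  open DirectSystem S

  ∼-at : ∀ {i j x y m} → (e : (i , x) ∼ (j , y)) → proj₁ e ≤ m →
         (p : i ≤ m) (q : j ≤ m) → δ i m p x ≡ δ j m q y
  ∼-at {i} {j} {x} {y} {m} (k , pk , qk , eq) k≤m p q = begin
    δ i m p x               ≡⟨ sym (δ-∘ i k m pk k≤m p x) ⟩
    δ k m k≤m (δ i k pk x)  ≡⟨ cong (δ k m k≤m) eq ⟩
    δ k m k≤m (δ j k qk y)  ≡⟨ δ-∘ j k m qk k≤m q y ⟩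
    δ j m q y               ∎
    where open ≡-Reasoning

  ∼-sym : ∀ {a b} → a ∼ b → b ∼ a
  ∼-sym (k , p , q , eq) = k , q , p , sym eq

  ∼-trans : ∀ {a b c} → a ∼ b → b ∼ c → a ∼ c
  ∼-trans {i , x} {j , y} {l , z} e₁@(k₁ , p , q , _) e₂@(k₂ , q′ , r , _) =
    m , ≤-trans p k₁≤m , ≤-trans r k₂≤m ,
    trans (∼-at e₁ k₁≤m _ (≤-trans q k₁≤m)) (∼-at e₂ k₂≤m _ _)
    where
    m = k₁ ⊔ k₂
    k₁≤m = m≤m⊔n k₁ k₂
    k₂≤m = m≤n⊔m k₁ k₂

  δ-∼ : ∀ {i j} (p : i ≤ j) (x : E i) → (j , δ i j p x) ∼ (i , x)
  δ-∼ {i} {j} p x = j , ≤-refl , p , δ-id j ≤-refl (δ i j p x)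

  δ-∼-δ : ∀ {i i′ l l′ x x′} (p : i ≤ l) (p′ : i′ ≤ l′) →
          (i , x) ∼ (i′ , x′) → (l , δ i l p x) ∼ (l′ , δ i′ l′ p′ x′)
  δ-∼-δ p p′ e = ∼-trans (δ-∼ p _) (∼-trans e (∼-sym (δ-∼ p′ _)))

  module CompatibleMaps
      (D : (i : ℕ) → E i → E i → Set)
      (D-Δ : ∀ i (p : i ≤ suc i) (x y : E i) → D i x y →
             D (suc i) (δ i (suc i) p x) (δ i (suc i) p y))
      (φ : (i : ℕ) → (x y : E i) → D i x y → E i)
      (φ-compat : ∀ i j (p : i ≤ j) (x y : E i) (d : D i x y)
                  (d′ : D j (δ i j p x) (δ i j p y)) →
                  δ i j p (φ i x y d) ≡ φ j (δ i j p x) (δ i j p y) d′)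
      where

    D-lift′ : ∀ {i k x y} → i ≤′ k → (p : i ≤ k) → D i x y → D k (δ i k p x) (δ i k p y)
    D-lift′ {i} {x = x} {y} ≤′-refl p d = subst₂ (D i) (sym (δ-id i p x)) (sym (δ-id i p y)) d
    D-lift′ {i} {suc k} {x} {y} (≤′-step i≤′k) p d =
      subst₂ (D (suc k)) (δ-∘ i k (suc k) i≤k k≤1+k p x) (δ-∘ i k (suc k) i≤k k≤1+k p y)
        (D-Δ k k≤1+k _ _ (D-lift′ i≤′k i≤k d))
      where
      i≤k = ≤′⇒≤ i≤′k
      k≤1+k = m≤n⇒m≤1+n ≤-refl

    D-lift : ∀ {i k x y} (p : i ≤ k) → D i x y → D k (δ i k p x) (δ i k p y)
    D-lift p = D-lift′ (≤⇒≤′ p) p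

    φ-subst : ∀ {k X X′ Y Y′} (eX : X ≡ X′) (eY : Y ≡ Y′) (d : D k X Y) →
              φ k X′ Y′ (subst₂ (D k) eX eY d) ≡ φ k X Y d
    φ-subst refl refl d = refl

    -- φ_k(x , y) does not depend on the membership proof: compatibility with δ_{k,k} = id.
    φ-irrelevant : ∀ {k X Y} (d d′ : D k X Y) → φ k X Y d ≡ φ k X Y d′
    φ-irrelevant {k} {X} {Y} d d′ = begin
      φ k X Y d                   ≡⟨ sym (δ-id k ≤-refl _) ⟩
      δ k k ≤-refl (φ k X Y d)    ≡⟨ φ-compat k k ≤-refl X Y d _ ⟩
      φ k _ _ (subst₂ (D k) (sym (δ-id k ≤-refl X)) (sym (δ-id k ≤-refl Y)) d′)
                                  ≡⟨ φ-subst _ _ d′ ⟩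
      φ k X Y d′                  ∎
      where open ≡-Reasoning

    φ-cong : ∀ {k X X′ Y Y′} → X ≡ X′ → Y ≡ Y′ → (d : D k X Y) (d′ : D k X′ Y′) →
             φ k X Y d ≡ φ k X′ Y′ d′
    φ-cong refl refl = φ-irrelevant

    φ-agree : ∀ {k k′ X Y X′ Y′} (d : D k X Y) (d′ : D k′ X′ Y′) →
              (k , X) ∼ (k′ , X′) → (k , Y) ∼ (k′ , Y′) →
              (k , φ k X Y d) ∼ (k′ , φ k′ X′ Y′ d′)
    φ-agree {k} {k′} {X} {Y} {X′} {Y′} d d′ eX@(kX , k≤kX , k′≤kX , _) eY@(kY , _) =
      m , k≤m , k′≤m , (begin
        δ k m k≤m (φ k X Y d)
          ≡⟨ φ-compat k m k≤m X Y d (D-lift k≤m d) ⟩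
        φ m (δ k m k≤m X) (δ k m k≤m Y) (D-lift k≤m d)
          ≡⟨ φ-cong (∼-at eX kX≤m k≤m k′≤m) (∼-at eY kY≤m k≤m k′≤m) _ (D-lift k′≤m d′) ⟩
        φ m (δ k′ m k′≤m X′) (δ k′ m k′≤m Y′) (D-lift k′≤m d′)
          ≡⟨ sym (φ-compat k′ m k′≤m X′ Y′ d′ (D-lift k′≤m d′)) ⟩
        δ k′ m k′≤m (φ k′ X′ Y′ d′) ∎)
      where
      open ≡-Reasoning
      m = kX ⊔ kY
      kX≤m = m≤m⊔n kX kY
      kY≤m = m≤n⊔m kX kY
      k≤m = ≤-trans k≤kX kX≤m
      k′≤m = ≤-trans k′≤kX kX≤m

    record DomainStage {i j} (x : E i) (y : E j) : Set where
      field
        l   : ℕ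
        i≤l : i ≤ l
        j≤l : j ≤ l
        inD : D l (δ i l i≤l x) (δ j l j≤l y)

      value : Lim
      value = l , φ l _ _ inD

    module Enumerated
        (u : (i : ℕ) → ℕ → E i)
        (u-surj : ∀ i (y : E i) → ∃ λ n → u i n ≡ y)
        (D-u : ∀ i (p : cγ i ≤ suc i) (x : E (suc i)) →
               D (suc i) x (δ (cγ i) (suc i) p (u (cγ i) (rγ i))))
        where

      D-u-at : ∀ {m c r} → γ⁻¹ m ≡ (c , r) → (p : c ≤ suc m) (x : E (suc m)) →
               D (suc m) x (δ c (suc m) p (u c r))
      D-u-at {m} eq p x with refl ← cong proj₁ eq | refl ← cong proj₂ eq = D-u m p x

      reach : ∀ {i j} (x : E i) (y : E j) → DomainStage x y
      reach {i} {j} x y = record { l = suc m ; i≤l = ≤-trans (m≤m⊔n i j) a≤l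
                                 ; j≤l = ≤-trans j≤a a≤l ; inD = subst (D (suc m) _) uₙ≡y d }
        where
        a = i ⊔ j
        j≤a = m≤n⊔m i j
        n = proj₁ (u-surj a (δ j a j≤a y))
        m = proj₁ (γ⁻¹-onto a n)
        γ⁻¹m = proj₂ (γ⁻¹-onto a n)
        a≤l : a ≤ suc m
        a≤l = subst (_≤ suc m) (cong proj₁ γ⁻¹m) (m≤n⇒m≤1+n (cγ-≤ m))
        d = D-u-at γ⁻¹m a≤l (δ i (suc m) (≤-trans (m≤m⊔n i j) a≤l) x)
        uₙ≡y : δ a (suc m) a≤l (u a n) ≡ δ j (suc m) (≤-trans j≤a a≤l) y
        uₙ≡y = trans (cong (δ a (suc m) a≤l) (proj₂ (u-surj a (δ j a j≤a y))))
                     (δ-∘ j a (suc m) j≤a a≤l _ y)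

      Φ : Lim → Lim → Lim
      Φ (i , x) (j , y) = DomainStage.value (reach x y)

      Φ-respects-∼ : ∀ a a′ b b′ → a ∼ a′ → b ∼ b′ → Φ a b ∼ Φ a′ b′
      Φ-respects-∼ (i , x) (i′ , x′) (j , y) (j′ , y′) ex ey =
        φ-agree _ _ (δ-∼-δ (i≤l s) (i≤l s′) ex) (δ-∼-δ (j≤l s) (j≤l s′) ey)
        where
        open DomainStage
        s = reach x y
        s′ = reach x′ y′

      Φ-extends-φ : ∀ i (x y : E i) (d : D i x y) → Φ (ι i x) (ι i y) ∼ ι i (φ i x y d)
      Φ-extends-φ i x y d = φ-agree _ d (δ-∼ (i≤l s) x) (δ-∼ (j≤l s) y)
        where
        open DomainStage
        s = reach x y

mainTheorem5 :
    (S : DirectSystem) → let open DirectSystem S in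
    (u : (i : ℕ) → ℕ → E i) →
    (u-surj : ∀ i (y : E i) → ∃ λ n → u i n ≡ y) →
    (D : (i : ℕ) → E i → E i → Set) →
    (D-Δ : ∀ i (p : i ≤ suc i) (x y : E i) → D i x y →
           D (suc i) (δ i (suc i) p x) (δ i (suc i) p y)) →
    (D-u : ∀ i (p : cγ i ≤ suc i) (x : E (suc i)) →
           D (suc i) x (δ (cγ i) (suc i) p (u (cγ i) (rγ i)))) →
    (φ : (i : ℕ) → (x y : E i) → D i x y → E i) →
    (φ-compat : ∀ i j (p : i ≤ j) (x y : E i) (d : D i x y)
                (d' : D j (δ i j p x) (δ i j p y)) →
                δ i j p (φ i x y d) ≡ φ j (δ i j p x) (δ i j p y) d') →
    Σ (Lim → Lim → Lim) λ Φ →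
      (∀ a a' b b' → a ∼ a' → b ∼ b' → Φ a b ∼ Φ a' b') ×
      (∀ i (x y : E i) (d : D i x y) → Φ (ι i x) (ι i y) ∼ ι i (φ i x y d))
mainTheorem5 S u u-surj D D-Δ D-u φ φ-compat = Φ , Φ-respects-∼ , Φ-extends-φ
  where
  open DirectLimit S
  open CompatibleMaps D D-Δ φ φ-compat
  open Enumerated u u-surj D-u
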